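{- Let $p$ be a prime and $d\geq 1$. An integer polynomial $f(x)$ is a null polynomial modulo $p^d$ if and only if there exist integer polynomials $q_1(x),\dots,q_d(x)$ such that $f(x)\equiv\sum_{j=1}^{d}p^{d-j}\mathcal{H}_{p,j}(x)q_j(x)\pmod{p^d}$ (coefficientwise), where $q_d(x)$ is an arbitrary polynomial of arbitrary degree, for $j<d$ one has $q_j(x)=0$ whenever $E_{\max}(\mathcal{H}_{p,j})=p$, and all other $q_j(x)$ are arbitrary polynomials of degree less than $p$.
   Context: An integer polynomial $f$ is a null polynomial modulo $m$ if $f(x)\equiv 0\pmod m$ for all integers $x$. Congruence of polynomials modulo $m$ means congruence of all corresponding coefficients. For a prime $p$: $I_p(0)=0$, $I_p(n)=\frac{p^n-1}{p-1}$ ($n\geq1$); $\mathcal{G}_{p,0}(x)=x$, $\mathcal{G}_{p,n}(x)=\prod_{i=0}^{p-1}\left(\mathcal{G}_{p,n-1}(x)-ip^{I_p(n-1)}\right)$ for $n\geq 1$. Exponents $(e_{d,i})_{i\geq1}$: $e_{0,i}=0$; for $d\geq 1$, if $\max_i e_{d-1,i}\leq p-1$ then $e_{d,1}=e_{d-1,1}+1$ and the others are unchanged; otherwise there is $i$ with $e_{d-1,i}=p$ and $e_{d-1,1}=\cdots=e_{d-1,i-1}=0$, and then $e_{d,i}=0$, $e_{d,i+1}=e_{d-1,i+1}+1$, others unchanged. $\mathcal{H}_{p,d}(x)=\prod_{i\geq 1}(\mathcal{G}_{p,i}(x))^{e_{d,i}}$, and $E_{\max}(\mathcal{H}_{p,d})=\max_i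 e_{d,i}$. -}

module Defs where

open import Data.Nat as ℕ using (ℕ; zero; suc; _≤?_; _∸_; _⊔_; _≟_)
open import Data.Integer as ℤ using (ℤ; +_; _-_)
open import Data.Integer.Divisibility using (_∣_)
open import Data.List using (List; []; _∷_; [_]; map; foldr; upTo)
open import Data.Bool using (if_then_else_)
open import Relation.Nullary using (does)

-- Integer polynomials as coefficient lists, lowest degree first.
Poly : Set
Poly = List ℤ

coeff : Poly → ℕ → ℤ
coeff []      _       = + 0
coeff (a ∷ f) zero    = a
coeff (a ∷ f) (suc k) = coeff f k

eval : Poly → ℤ → ℤ
eval []      x = + 0
eval (a ∷ f) x = a ℤ.+ x ℤ.* eval f x

infixl 6 _+P_
infixl 7 _*P_ _·P_

_+P_ : Poly → Poly → Poly
[]      +P g       = g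
(a ∷ f) +P []      = a ∷ f
(a ∷ f) +P (b ∷ g) = (a ℤ.+ b) ∷ (f +P g)

_·P_ : ℤ → Poly → Poly
a ·P f = map (a ℤ.*_) f

_*P_ : Poly → Poly → Poly
[]      *P g = []
(a ∷ f) *P g = (a ·P g) +P (+ 0 ∷ (f *P g))

oneP : Poly
oneP = [ + 1 ]

xP : Poly
xP = + 0 ∷ + 1 ∷ []

_^P_ : Poly → ℕ → Poly
f ^P zero  = oneP
f ^P suc n = f *P (f ^P n)

prodP : List Poly → Poly
prodP = foldr _*P_ oneP

NullMod : ℕ → Poly → Set
NullMod m f = ∀ (x : ℤ) → (+ m) ∣ eval f x

CongMod : ℕ → Poly → Poly → Set
CongMod m f g = ∀ (k : ℕ) → (+ m) ∣ (coeff f k - coeff g k)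

IsZeroP : Poly → Set
IsZeroP q = ∀ k → coeff q k ≡ + 0
  where open import Relation.Binary.PropositionalEquality using (_≡_)

DegLt : ℕ → Poly → Set
DegLt n q = ∀ k → n ℕ.≤ k → coeff q k ≡ + 0
  where open import Relation.Binary.PropositionalEquality using (_≡_)

-- I_p(n) = (p^n - 1)/(p - 1) for n ≥ 1, I_p(0) = 0,
-- computed via I_p(n+1) = p * I_p(n) + 1 (= 1 + p + ... + p^n).
I : ℕ → ℕ → ℕ
I p zero    = 0
I p (suc n) = suc (p ℕ.* I p n)

G : ℕ → ℕ → Poly
G p zero    = xP
G p (suc n) = prodP (map (λ i → G p n +P [ ℤ.- (+ (i ℕ.* p ℕ.^ I p n)) ]) (upTo p))

-- Exponent sequences (e_{d,1}, e_{d,2}, ...) as a list; entries beyond the list are 0.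
incE : List ℕ → List ℕ
incE []       = [ 1 ]
incE (e ∷ es) = suc e ∷ es

carryE : ℕ → List ℕ → List ℕ
carryE p []       = []
carryE p (e ∷ es) = if does (e ≟ p) then 0 ∷ incE es else e ∷ carryE p es

maxE : List ℕ → ℕ
maxE = foldr _⊔_ 0

stepE : ℕ → List ℕ → List ℕ
stepE p es = if does (maxE es ≤? p ∸ 1) then incE es else carryE p es

e : ℕ → ℕ → List ℕ
e p zero    = []
e p (suc d) = stepE p (e p d)

Hfrom : ℕ → ℕ → List ℕ → Poly
Hfrom p i []       = oneP
Hfrom p i (k ∷ es) = (G p i ^P k) *P Hfrom p (suc i) es

H : ℕ → ℕ → Poly
H p d = Hfrom p 1 (e p d)

Emax : ℕ → ℕ → ℕ
Emax p d = maxE (e p d)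

sumP : (ℕ → Poly) → ℕ → Poly
sumP t zero    = []
sumP t (suc n) = sumP t n +P t (suc n)

rhs : ℕ → ℕ → (ℕ → Poly) → Poly
rhs p d q = sumP (λ j → (+ (p ℕ.^ (d ∸ j))) ·P (H p j *P q j)) d

-- For every integer x, G_{p,n}(x) is divisible by p^{I_p(n)}: it is the product
-- of p values c t, c (t - 1), ..., c (t - p + 1) with c = p^{I_p(n-1)}, one of which carries an
-- extra factor p. The exponents are arranged so that Σ_i e_{j,i} I_p(i) = j, hence p^j divides
-- H_{p,j}(x) and every summand p^{d-j} H_{p,j} q_j is null modulo p^d.
--
-- Necessity, by induction on the degree n of a null polynomial f. The polynomial H_{p,j} is monic
-- of degree D_j = Σ_i e_{j,i} p^i. The n-th finite difference of f is n! times its top coefficient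
-- and is divisible by p^d. If D_j ≤ n < D_j + p with all e_{j,i} < p, then n - D_j, e_{j,1},
-- e_{j,2}, ... are the base-p digits of n, so Legendre's formula gives v_p(n!) = j; the top
-- coefficient is then a multiple of p^{d-j}, and subtracting p^{d-j} H_{p,j} times a monomial of
-- degree n - D_j < p lowers the degree. If no j < d admits such a window, then D_d ≤ n and j = d
-- serves, with an unrestricted multiplier.
module Submission where

open import Defs
open import Data.Nat using (ℕ; zero; suc; s≤s; nonTrivial⇒n>1)
open import Data.Nat.Primality using (Prime; prime⇒nonTrivial)
open import Data.Product using (Σ; _×_; _,_; proj₁; proj₂)
open import Data.Sum using (_⊎_; inj₁; inj₂)
open import Data.List using (List; []; _∷_; [_]; map; length; upTo)
open import Function.Base using (_∘_)
open import Function.Bundles using (_⇔_; mk⇔)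
open import Relation.Binary.PropositionalEquality
  using (_≡_; _≢_; refl; sym; trans; cong; cong₂; subst; subst₂; module ≡-Reasoning)

module Polynomials where

  open import Data.Nat as ℕ using (_≤_; z≤n)
  import Data.Nat.Properties as ℕₚ
  open import Data.Integer using (ℤ; +_; -_; _+_; _*_; _-_; _^_)
  open import Data.Integer.Properties
    using (+-identityˡ; +-identityʳ; +-inverseʳ; *-zeroˡ; *-zeroʳ; *-identityʳ)
  open import Data.Integer.Divisibility.Signed
    using (_∣_; divides; ∣ᵤ⇒∣; ∣⇒∣ᵤ; ∣m∣n⇒∣m+n; ∣m∣n⇒∣m-n; ∣n⇒∣m*n)
  open import Data.Integer.Tactic.RingSolver using (solve-∀)
  open import Relation.Nullary using (yes; no)
  open ≡-Reasoning

  infixl 6 _-P_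

  _-P_ : Poly → Poly → Poly
  f -P g = f +P (- + 1) ·P g

  monomial : ℤ → ℕ → Poly
  monomial w zero    = [ w ]
  monomial w (suc k) = + 0 ∷ monomial w k

  TopCoeff : ℕ → ℤ → Poly → Set
  TopCoeff n c f = DegLt (suc n) f × coeff f n ≡ c

  coeff-+P : ∀ f g k → coeff (f +P g) k ≡ coeff f k + coeff g k
  coeff-+P []      g       k       = sym (+-identityˡ _)
  coeff-+P (a ∷ f) []      k       = sym (+-identityʳ _)
  coeff-+P (a ∷ f) (b ∷ g) zero    = refl
  coeff-+P (a ∷ f) (b ∷ g) (suc k) = coeff-+P f g k

  coeff-·P : ∀ a f k → coeff (a ·P f) k ≡ a * coeff f k
  coeff-·P a []      k       = sym (*-zeroʳ a)
  coeff-·P a (b ∷ f) zero    = refl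
  coeff-·P a (b ∷ f) (suc k) = coeff-·P a f k

  coeff--P : ∀ f g k → coeff (f -P g) k ≡ coeff f k - coeff g k
  coeff--P f g k = begin
    coeff (f +P (- + 1) ·P g) k        ≡⟨ coeff-+P f _ k ⟩
    coeff f k + coeff ((- + 1) ·P g) k ≡⟨ cong (λ t → coeff f k + t) (coeff-·P (- + 1) g k) ⟩
    coeff f k + - + 1 * coeff g k      ≡⟨ negate (coeff f k) (coeff g k) ⟩
    coeff f k - coeff g k              ∎
    where
    negate : ∀ a b → a + - + 1 * b ≡ a - b
    negate = solve-∀

  coeff-∷*P : ∀ a f g k → coeff ((a ∷ f) *P g) k ≡ a * coeff g k + coeff (+ 0 ∷ f *P g) k
  coeff-∷*P a f g k =
    trans (coeff-+P (a ·P g) _ k) (cong (λ t → t + coeff (+ 0 ∷ f *P g) k) (coeff-·P a g k))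

  coeff-*P-+P : ∀ f g h k → coeff (f *P (g +P h)) k ≡ coeff (f *P g) k + coeff (f *P h) k
  coeff-*P-+P []      g h k = refl
  coeff-*P-+P (a ∷ f) g h k = begin
    coeff ((a ∷ f) *P (g +P h)) k
      ≡⟨ coeff-∷*P a f (g +P h) k ⟩
    a * coeff (g +P h) k + coeff (+ 0 ∷ f *P (g +P h)) k
      ≡⟨ cong₂ (λ u v → a * u + v) (coeff-+P g h k) (shifted k) ⟩
    a * (coeff g k + coeff h k) + (coeff (+ 0 ∷ f *P g) k + coeff (+ 0 ∷ f *P h) k)
      ≡⟨ distribute a (coeff g k) (coeff h k) _ _ ⟩
    (a * coeff g k + coeff (+ 0 ∷ f *P g) k) + (a * coeff h k + coeff (+ 0 ∷ f *P h) k)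
      ≡⟨ sym (cong₂ _+_ (coeff-∷*P a f g k) (coeff-∷*P a f h k)) ⟩
    coeff ((a ∷ f) *P g) k + coeff ((a ∷ f) *P h) k ∎
    where
    shifted : ∀ k → coeff (+ 0 ∷ f *P (g +P h)) k ≡ coeff (+ 0 ∷ f *P g) k + coeff (+ 0 ∷ f *P h) k
    shifted zero    = refl
    shifted (suc k) = coeff-*P-+P f g h k
    distribute : ∀ a u v s t → a * (u + v) + (s + t) ≡ (a * u + s) + (a * v + t)
    distribute = solve-∀

  *P-zeroʳ : ∀ f → IsZeroP (f *P [])
  *P-zeroʳ []      k       = refl
  *P-zeroʳ (a ∷ f) zero    = refl
  *P-zeroʳ (a ∷ f) (suc k) = *P-zeroʳ f k

  *P-zeroˡ : ∀ {f} g → IsZeroP f → IsZeroP (f *P g)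
  *P-zeroˡ {[]}    g f≡0 k = refl
  *P-zeroˡ {a ∷ f} g f≡0 k = begin
    coeff ((a ∷ f) *P g) k                 ≡⟨ coeff-∷*P a f g k ⟩
    a * coeff g k + coeff (+ 0 ∷ f *P g) k ≡⟨ cong₂ _+_ (cong (_* coeff g k) (f≡0 0)) (shifted k) ⟩
    + 0 * coeff g k + + 0                  ≡⟨ cong (λ t → t + + 0) (*-zeroˡ (coeff g k)) ⟩
    + 0                                    ∎
    where
    shifted : IsZeroP (+ 0 ∷ f *P g)
    shifted zero    = refl
    shifted (suc k) = *P-zeroˡ {f} g (λ k → f≡0 (suc k)) k

  eval-+P : ∀ f g x → eval (f +P g) x ≡ eval f x + eval g x
  eval-+P []      g       x = sym (+-identityˡ _)
  eval-+P (a ∷ f) []      x = sym (+-identityʳ _)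
  eval-+P (a ∷ f) (b ∷ g) x =
    trans (cong (λ t → (a + b) + x * t) (eval-+P f g x)) (regroup a b x (eval f x) (eval g x))
    where
    regroup : ∀ a b x u v → (a + b) + x * (u + v) ≡ (a + x * u) + (b + x * v)
    regroup = solve-∀

  eval-·P : ∀ a f x → eval (a ·P f) x ≡ a * eval f x
  eval-·P a []      x = sym (*-zeroʳ a)
  eval-·P a (b ∷ f) x = trans (cong (λ t → a * b + x * t) (eval-·P a f x)) (regroup a b x (eval f x))
    where
    regroup : ∀ a b x u → a * b + x * (a * u) ≡ a * (b + x * u)
    regroup = solve-∀

  eval-*P : ∀ f g x → eval (f *P g) x ≡ eval f x * eval g x
  eval-*P []      g x = sym (*-zeroˡ (eval g x))
  eval-*P (a ∷ f) g x = begin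
    eval ((a ·P g) +P (+ 0 ∷ f *P g)) x
      ≡⟨ eval-+P (a ·P g) _ x ⟩
    eval (a ·P g) x + (+ 0 + x * eval (f *P g) x)
      ≡⟨ cong₂ (λ u v → u + (+ 0 + x * v)) (eval-·P a g x) (eval-*P f g x) ⟩
    a * eval g x + (+ 0 + x * (eval f x * eval g x))
      ≡⟨ regroup a x (eval f x) (eval g x) ⟩
    (a + x * eval f x) * eval g x ∎
    where
    regroup : ∀ a x u v → a * v + (+ 0 + x * (u * v)) ≡ (a + x * u) * v
    regroup = solve-∀

  eval-const : ∀ c x → eval [ c ] x ≡ c
  eval-const c x = trans (cong (λ t → c + t) (*-zeroʳ x)) (+-identityʳ c)

  eval-^P : ∀ f k x → eval (f ^P k) x ≡ eval f x ^ k
  eval-^P f zero    x = eval-const (+ 1) x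
  eval-^P f (suc k) x = trans (eval-*P f (f ^P k) x) (cong (eval f x *_) (eval-^P f k x))

  eval--P : ∀ f g x → eval (f -P g) x ≡ eval f x - eval g x
  eval--P f g x =
    trans (eval-+P f _ x) (trans (cong (λ t → eval f x + t) (eval-·P (- + 1) g x)) (negate (eval f x) (eval g x)))
    where
    negate : ∀ a b → a + - + 1 * b ≡ a - b
    negate = solve-∀

  eval-monomial : ∀ w k x → eval (monomial w k) x ≡ w * x ^ k
  eval-monomial w zero    x = trans (eval-const w x) (sym (*-identityʳ w))
  eval-monomial w (suc k) x = trans (cong (λ t → + 0 + x * t) (eval-monomial w k x)) (regroup w x (x ^ k))
    where
    regroup : ∀ w x y → + 0 + x * (w * y) ≡ w * (x * y)
    regroup = solve-∀

  eval-IsZeroP : ∀ f x → IsZeroP f → eval f x ≡ + 0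
  eval-IsZeroP []      x f≡0 = refl
  eval-IsZeroP (a ∷ f) x f≡0 =
    trans (cong₂ (λ u v → u + x * v) (f≡0 0) (eval-IsZeroP f x (λ k → f≡0 (suc k))))
          (cong (λ t → + 0 + t) (*-zeroʳ x))

  ∣-eval : ∀ {m} f x → (∀ k → m ∣ coeff f k) → m ∣ eval f x
  ∣-eval []      x m∣f = divides (+ 0) refl
  ∣-eval (a ∷ f) x m∣f = ∣m∣n⇒∣m+n (m∣f 0) (∣n⇒∣m*n x (∣-eval f x (λ k → m∣f (suc k))))

  TopCoeff-*P : ∀ {a b u v} f g → TopCoeff a u f → TopCoeff b v g → TopCoeff (a ℕ.+ b) (u * v) (f *P g)
  TopCoeff-*P {v = v} [] g (_ , refl) _ = (λ k _ → refl) , sym (*-zeroˡ v)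
  TopCoeff-*P {zero} {b} (x ∷ f) g (f<1 , refl) (g<b+1 , refl) = deg , top
    where
    tail≡0 : IsZeroP (+ 0 ∷ f *P g)
    tail≡0 zero    = refl
    tail≡0 (suc k) = *P-zeroˡ {f} g (λ k → f<1 (suc k) (s≤s z≤n)) k
    deg : DegLt (suc b) ((x ∷ f) *P g)
    deg k b<k = begin
      coeff ((x ∷ f) *P g) k                 ≡⟨ coeff-∷*P x f g k ⟩
      x * coeff g k + coeff (+ 0 ∷ f *P g) k ≡⟨ cong₂ (λ s t → x * s + t) (g<b+1 k b<k) (tail≡0 k) ⟩
      x * + 0 + + 0                          ≡⟨ cong (λ s → s + + 0) (*-zeroʳ x) ⟩
      + 0                                    ∎
    top : coeff ((x ∷ f) *P g) b ≡ x * coeff g b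
    top = trans (coeff-∷*P x f g b) (trans (cong (λ t → x * coeff g b + t) (tail≡0 b)) (+-identityʳ _))
  TopCoeff-*P {suc a} {b} (x ∷ f) g (f<a+2 , refl) (g<b+1 , refl) = deg , top
    where
    ih : TopCoeff (a ℕ.+ b) (coeff f a * coeff g b) (f *P g)
    ih = TopCoeff-*P f g ((λ k a<k → f<a+2 (suc k) (s≤s a<k)) , refl) (g<b+1 , refl)
    x*g≡0 : ∀ k → b ℕ.< suc k → x * coeff g (suc k) ≡ + 0
    x*g≡0 k b<k = trans (cong (x *_) (g<b+1 (suc k) b<k)) (*-zeroʳ x)
    b≤a+b : b ≤ a ℕ.+ b
    b≤a+b = ℕₚ.m≤n+m b a
    deg : DegLt (suc (suc a ℕ.+ b)) ((x ∷ f) *P g)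
    deg (suc k) (s≤s a+b<k) = begin
      coeff ((x ∷ f) *P g) (suc k)
        ≡⟨ coeff-∷*P x f g (suc k) ⟩
      x * coeff g (suc k) + coeff (f *P g) k
        ≡⟨ cong₂ _+_ (x*g≡0 k (s≤s (ℕₚ.≤-trans b≤a+b (ℕₚ.<⇒≤ a+b<k)))) (proj₁ ih k a+b<k) ⟩
      + 0 ∎
    top : coeff ((x ∷ f) *P g) (suc (a ℕ.+ b)) ≡ coeff f a * coeff g b
    top = begin
      coeff ((x ∷ f) *P g) (suc (a ℕ.+ b))
        ≡⟨ coeff-∷*P x f g (suc (a ℕ.+ b)) ⟩
      x * coeff g (suc (a ℕ.+ b)) + coeff (f *P g) (a ℕ.+ b)
        ≡⟨ cong₂ _+_ (x*g≡0 (a ℕ.+ b) (s≤s b≤a+b)) (proj₂ ih) ⟩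
      + 0 + coeff f a * coeff g b
        ≡⟨ +-identityˡ _ ⟩
      coeff f a * coeff g b ∎

  TopCoeff-·P : ∀ {n u} c f → TopCoeff n u f → TopCoeff n (c * u) (c ·P f)
  TopCoeff-·P c f (f<n+1 , refl) =
    (λ k n<k → trans (coeff-·P c f k) (trans (cong (c *_) (f<n+1 k n<k)) (*-zeroʳ c))) , coeff-·P c f _

  TopCoeff-+P-const : ∀ {n u} f c → 1 ≤ n → TopCoeff n u f → TopCoeff n u (f +P [ c ])
  TopCoeff-+P-const {n} f c 1≤n (f<n+1 , refl) = deg , top
    where
    const≡0 : ∀ k → 1 ≤ k → coeff [ c ] k ≡ + 0
    const≡0 (suc k) _ = refl
    deg : DegLt (suc n) (f +P [ c ])
    deg k n<k = trans (coeff-+P f [ c ] k) (cong₂ _+_ (f<n+1 k n<k) (const≡0 k (ℕₚ.≤-trans (s≤s z≤n) n<k)))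
    top : coeff (f +P [ c ]) n ≡ coeff f n
    top = trans (coeff-+P f [ c ] n) (trans (cong (λ t → coeff f n + t) (const≡0 n 1≤n)) (+-identityʳ _))

  TopCoeff-oneP : TopCoeff 0 (+ 1) oneP
  TopCoeff-oneP = (λ { (suc k) _ → refl }) , refl

  TopCoeff-xP : TopCoeff 1 (+ 1) xP
  TopCoeff-xP = (λ { (suc (suc k)) _ → refl ; (suc zero) (s≤s ()) }) , refl

  TopCoeff-^P : ∀ {a} f k → TopCoeff a (+ 1) f → TopCoeff (k ℕ.* a) (+ 1) (f ^P k)
  TopCoeff-^P f zero    top = TopCoeff-oneP
  TopCoeff-^P f (suc k) top = TopCoeff-*P f (f ^P k) top (TopCoeff-^P f k top)

  TopCoeff-prodP : ∀ {a} (F : ℕ → Poly) L → (∀ i → TopCoeff a (+ 1) (F i)) →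
                   TopCoeff (length L ℕ.* a) (+ 1) (prodP (map F L))
  TopCoeff-prodP F []      top = TopCoeff-oneP
  TopCoeff-prodP F (i ∷ L) top = TopCoeff-*P (F i) _ (top i) (TopCoeff-prodP F L top)

  TopCoeff-monomial : ∀ w k → TopCoeff k w (monomial w k)
  TopCoeff-monomial w zero    = (λ { (suc i) _ → refl }) , refl
  TopCoeff-monomial w (suc k) =
    (λ { (suc i) (s≤s k<i) → proj₁ (TopCoeff-monomial w k) i k<i }) , proj₂ (TopCoeff-monomial w k)

  DegLt-dropTop : ∀ {n} f t → DegLt (suc n) f → TopCoeff n (coeff f n) t → DegLt n (f -P t)
  DegLt-dropTop {n} f t f<n+1 (t<n+1 , t≡) k n≤k with ℕₚ.m≤n⇒m<n∨m≡n n≤k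
  ... | inj₁ n<k  = trans (coeff--P f t k) (cong₂ _-_ (f<n+1 k n<k) (t<n+1 k n<k))
  ... | inj₂ refl = trans (coeff--P f t n) (trans (cong (λ s → coeff f n - s) t≡) (+-inverseʳ (coeff f n)))

  DegLt-length : ∀ f → DegLt (length f) f
  DegLt-length []      k       _         = refl
  DegLt-length (a ∷ f) (suc k) (s≤s f<k) = DegLt-length f k f<k

  coeff-sumP-zero : ∀ (t : ℕ → Poly) n k → (∀ j → j ≤ n → coeff (t j) k ≡ + 0) →
                    coeff (sumP t n) k ≡ + 0
  coeff-sumP-zero t zero    k t≡0 = refl
  coeff-sumP-zero t (suc n) k t≡0 =
    trans (coeff-+P (sumP t n) (t (suc n)) k)
          (cong₂ _+_ (coeff-sumP-zero t n k (λ j j≤n → t≡0 j (ℕₚ.m≤n⇒m≤1+n j≤n)))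
                     (t≡0 (suc n) ℕₚ.≤-refl))

  coeff-sumP-single : ∀ (t : ℕ → Poly) n k {j} → 1 ≤ j → j ≤ n →
                      (∀ i → i ≢ j → coeff (t i) k ≡ + 0) → coeff (sumP t n) k ≡ coeff (t j) k
  coeff-sumP-single t zero    k (s≤s z≤n) ()
  coeff-sumP-single t (suc n) k {j} 1≤j j≤n+1 t≡0 with j ℕ.≟ suc n
  ... | yes refl = begin
    coeff (sumP t n +P t j) k          ≡⟨ coeff-+P (sumP t n) (t j) k ⟩
    coeff (sumP t n) k + coeff (t j) k ≡⟨ cong (λ s → s + coeff (t j) k) (coeff-sumP-zero t n k below-j≡0) ⟩
    + 0 + coeff (t j) k                ≡⟨ +-identityˡ _ ⟩
    coeff (t j) k                      ∎
    where
    below-j≡0 : ∀ i → i ≤ n → coeff (t i) k ≡ + 0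
    below-j≡0 i i≤n = t≡0 i (ℕₚ.<⇒≢ (s≤s i≤n))
  ... | no j≢n+1 = begin
    coeff (sumP t n +P t (suc n)) k
      ≡⟨ coeff-+P (sumP t n) (t (suc n)) k ⟩
    coeff (sumP t n) k + coeff (t (suc n)) k
      ≡⟨ cong₂ _+_ (coeff-sumP-single t n k 1≤j j≤n t≡0) (t≡0 (suc n) (j≢n+1 ∘ sym)) ⟩
    coeff (t j) k + + 0
      ≡⟨ +-identityʳ _ ⟩
    coeff (t j) k ∎
    where
    j≤n : j ≤ n
    j≤n = ℕₚ.≤-pred (ℕₚ.≤∧≢⇒< j≤n+1 j≢n+1)

  IsZeroP-+P : ∀ f g → IsZeroP f → IsZeroP g → IsZeroP (f +P g)
  IsZeroP-+P f g f≡0 g≡0 k = trans (coeff-+P f g k) (cong₂ _+_ (f≡0 k) (g≡0 k))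

  DegLt-+P : ∀ {n} f g → DegLt n f → DegLt n g → DegLt n (f +P g)
  DegLt-+P f g f<n g<n k n≤k = trans (coeff-+P f g k) (cong₂ _+_ (f<n k n≤k) (g<n k n≤k))

  coeff-sumP-additive : ∀ (s t u : ℕ → Poly) n k → (∀ j → coeff (s j) k ≡ coeff (t j) k + coeff (u j) k) →
                        coeff (sumP s n) k ≡ coeff (sumP t n) k + coeff (sumP u n) k
  coeff-sumP-additive s t u zero    k s≡t+u = refl
  coeff-sumP-additive s t u (suc n) k s≡t+u = begin
    coeff (sumP s n +P s (suc n)) k
      ≡⟨ coeff-+P (sumP s n) (s (suc n)) k ⟩
    coeff (sumP s n) k + coeff (s (suc n)) k
      ≡⟨ cong₂ _+_ (coeff-sumP-additive s t u n k s≡t+u) (s≡t+u (suc n)) ⟩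
    (coeff (sumP t n) k + coeff (sumP u n) k) + (coeff (t (suc n)) k + coeff (u (suc n)) k)
      ≡⟨ regroup (coeff (sumP t n) k) _ _ _ ⟩
    (coeff (sumP t n) k + coeff (t (suc n)) k) + (coeff (sumP u n) k + coeff (u (suc n)) k)
      ≡⟨ sym (cong₂ _+_ (coeff-+P (sumP t n) (t (suc n)) k) (coeff-+P (sumP u n) (u (suc n)) k)) ⟩
    coeff (sumP t (suc n)) k + coeff (sumP u (suc n)) k ∎
    where
    regroup : ∀ a b c d → (a + b) + (c + d) ≡ (a + c) + (b + d)
    regroup = solve-∀

  ∣-eval-sumP : ∀ {m} (t : ℕ → Poly) n x → (∀ j → j ≤ n → m ∣ eval (t j) x) → m ∣ eval (sumP t n) x
  ∣-eval-sumP t zero    x m∣t = divides (+ 0) refl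
  ∣-eval-sumP t (suc n) x m∣t = subst (_ ∣_) (sym (eval-+P (sumP t n) (t (suc n)) x))
    (∣m∣n⇒∣m+n (∣-eval-sumP t n x (λ j j≤n → m∣t j (ℕₚ.m≤n⇒m≤1+n j≤n)))
               (m∣t (suc n) ℕₚ.≤-refl))

  NullMod-resp-CongMod : ∀ {m} f g → CongMod m f g → NullMod m g → NullMod m f
  NullMod-resp-CongMod {m} f g f≡g g-null x =
    ∣⇒∣ᵤ (subst (+ m ∣_) f-g+g≡f (∣m∣n⇒∣m+n (∣-eval (f -P g) x m∣f-g) (∣ᵤ⇒∣ (g-null x))))
    where
    m∣f-g : ∀ k → + m ∣ coeff (f -P g) k
    m∣f-g k = subst (+ m ∣_) (sym (coeff--P f g k)) (∣ᵤ⇒∣ (f≡g k))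
    f-g+g≡f : eval (f -P g) x + eval g x ≡ eval f x
    f-g+g≡f = trans (cong (λ t → t + eval g x) (eval--P f g x)) (cancel (eval f x) (eval g x))
      where
      cancel : ∀ a b → a - b + b ≡ a
      cancel = solve-∀

  NullMod--P : ∀ {m} f g → NullMod m f → NullMod m g → NullMod m (f -P g)
  NullMod--P {m} f g f-null g-null x = ∣⇒∣ᵤ (subst (+ m ∣_) (sym (eval--P f g x))
    (∣m∣n⇒∣m-n (∣ᵤ⇒∣ {i = eval f x} (f-null x)) (∣ᵤ⇒∣ {i = eval g x} (g-null x))))

module FiniteDifferences where

  open import Data.Nat using (_!; z≤n)
  open import Data.Integer using (ℤ; +_; _+_; _*_; _-_; _^_)
  open import Data.Integer.Properties using (pos-*; *-zeroʳ)
  open import Data.Integer.Divisibility.Signed using (_∣_; ∣ᵤ⇒∣; ∣m∣n⇒∣m-n)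
  open import Data.Integer.Tactic.RingSolver using (solve-∀)
  open Polynomials

  -- FunDegLt n h: h is a polynomial function of degree < n; a witness lists its
  -- coefficients from the top down.
  mutual
    FunDegLt : ℕ → (ℤ → ℤ) → Set
    FunDegLt zero    h = ∀ x → h x ≡ + 0
    FunDegLt (suc n) h = Σ ℤ λ c → FunTopCoeff n c h

    FunTopCoeff : ℕ → ℤ → (ℤ → ℤ) → Set
    FunTopCoeff n c h = FunDegLt n (λ x → h x - c * x ^ n)

  FunDegLt-resp : ∀ n {h h′} → (∀ x → h x ≡ h′ x) → FunDegLt n h → FunDegLt n h′
  FunDegLt-resp zero    h≡h′ h≡0       x = trans (sym (h≡h′ x)) (h≡0 x)
  FunDegLt-resp (suc n) h≡h′ (c , top) = c , FunDegLt-resp n (λ x → cong (λ t → t - c * x ^ n) (h≡h′ x)) top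

  FunDegLt-zero : ∀ n {h} → (∀ x → h x ≡ + 0) → FunDegLt n h
  FunDegLt-zero zero    h≡0 = h≡0
  FunDegLt-zero (suc n) h≡0 = + 0 , FunDegLt-zero n (λ x → cong (λ t → t - + 0 * x ^ n) (h≡0 x))

  FunDegLt-+ : ∀ n {h h′} → FunDegLt n h → FunDegLt n h′ → FunDegLt n (λ x → h x + h′ x)
  FunDegLt-+ zero    h≡0 h′≡0 x = cong₂ _+_ (h≡0 x) (h′≡0 x)
  FunDegLt-+ (suc n) {h} {h′} (c , top) (c′ , top′) =
    c + c′ , FunDegLt-resp n (λ x → regroup (h x) (h′ x) c c′ (x ^ n)) (FunDegLt-+ n top top′)
    where
    regroup : ∀ a b c c′ y → (a - c * y) + (b - c′ * y) ≡ a + b - (c + c′) * y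
    regroup = solve-∀

  FunDegLt-*ˡ : ∀ n a {h} → FunDegLt n h → FunDegLt n (λ x → a * h x)
  FunDegLt-*ˡ zero    a     h≡0       x = trans (cong (a *_) (h≡0 x)) (*-zeroʳ a)
  FunDegLt-*ˡ (suc n) a {h} (c , top) =
    a * c , FunDegLt-resp n (λ x → distrib a (h x) c (x ^ n)) (FunDegLt-*ˡ n a top)
    where
    distrib : ∀ a b c y → a * (b - c * y) ≡ a * b - a * c * y
    distrib = solve-∀

  FunDegLt-suc : ∀ n {h} → FunDegLt n h → FunDegLt (suc n) h
  FunDegLt-suc n {h} h<n = + 0 , FunDegLt-resp n (λ x → minus-zero (h x) (x ^ n)) h<n
    where
    minus-zero : ∀ a y → a ≡ a - + 0 * y
    minus-zero = solve-∀

  FunDegLt-x* : ∀ n {h} → FunDegLt n h → FunDegLt (suc n) (λ x → x * h x)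
  FunDegLt-x* zero    {h} h≡0 = + 0 , λ x → trans (cancel x (h x)) (trans (cong (x *_) (h≡0 x)) (*-zeroʳ x))
    where
    cancel : ∀ x a → x * a - + 0 * + 1 ≡ x * a
    cancel = solve-∀
  FunDegLt-x* (suc n) {h} (c , top) =
    c , FunDegLt-resp (suc n) (λ x → distrib x (h x) c (x ^ n)) (FunDegLt-x* n top)
    where
    distrib : ∀ x a c y → x * (a - c * y) ≡ x * a - c * (x * y)
    distrib = solve-∀

  FunDegLt-^ : ∀ n → FunDegLt (suc n) (_^ n)
  FunDegLt-^ n = + 1 , FunDegLt-zero n (λ x → cancel (x ^ n))
    where
    cancel : ∀ y → y - + 1 * y ≡ + 0
    cancel = solve-∀

  eval-FunDegLt : ∀ n f → DegLt n f → FunDegLt n (eval f)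
  eval-FunDegLt zero    f f<0   x = eval-IsZeroP f x (λ k → f<0 k z≤n)
  eval-FunDegLt (suc n) f f<n+1   = coeff f n ,
    FunDegLt-resp n (λ x → trans (eval--P f t x) (cong (λ s → eval f x - s) (eval-monomial (coeff f n) n x)))
      (eval-FunDegLt n (f -P t) (DegLt-dropTop f t f<n+1 (TopCoeff-monomial (coeff f n) n)))
    where
    t : Poly
    t = monomial (coeff f n) n

  Δ : (ℤ → ℤ) → ℤ → ℤ
  Δ h x = h (x + + 1) - h x

  Δ^ : ℕ → (ℤ → ℤ) → ℤ → ℤ
  Δ^ zero    h = h
  Δ^ (suc n) h = Δ^ n (Δ h)

  binomialRemainder : ℕ → ℤ → ℤ
  binomialRemainder m x = (x + + 1) ^ suc m - x ^ suc m - + suc m * x ^ m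

  FunDegLt-binomialRemainder : ∀ m → FunDegLt m (binomialRemainder m)
  FunDegLt-binomialRemainder zero x = cancel x
    where
    cancel : ∀ x → (x + + 1) * + 1 - x * + 1 - + 1 * + 1 ≡ + 0
    cancel = solve-∀
  FunDegLt-binomialRemainder (suc m) =
    FunDegLt-resp (suc m) (λ x → sym (recurrence x ((x + + 1) ^ m) (x ^ m) (+ m)))
      (FunDegLt-+ (suc m) {λ x → + suc m * x ^ m} (FunDegLt-*ˡ (suc m) (+ suc m) {_^ m} (FunDegLt-^ m))
        (FunDegLt-+ (suc m) {λ x → x * binomialRemainder m x} (FunDegLt-x* m R) (FunDegLt-suc m R)))
    where
    R : FunDegLt m (binomialRemainder m)
    R = FunDegLt-binomialRemainder m
    recurrence : ∀ x A B M →
      (x + + 1) * ((x + + 1) * A) - x * (x * B) - (+ 1 + (+ 1 + M)) * (x * B)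
      ≡ (+ 1 + M) * B + (x * ((x + + 1) * A - x * B - (+ 1 + M) * B) + ((x + + 1) * A - x * B - (+ 1 + M) * B))
    recurrence = solve-∀

  mutual
    FunDegLt-Δ : ∀ n {g} → FunDegLt (suc n) g → FunDegLt n (Δ g)
    FunDegLt-Δ zero    {g} (c , g≡c) x =
      trans (sym (shift (g (x + + 1)) (g x) c)) (cong₂ _-_ (g≡c (x + + 1)) (g≡c x))
      where
      shift : ∀ a b c → (a - c * + 1) - (b - c * + 1) ≡ a - b
      shift = solve-∀
    FunDegLt-Δ (suc m) {g} (c , top) = c * + suc m , FunTopCoeff-Δ m c g top

    FunTopCoeff-Δ : ∀ n c h → FunTopCoeff (suc n) c h → FunTopCoeff n (c * + suc n) (Δ h)
    FunTopCoeff-Δ n c h top =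
      FunDegLt-resp n (λ x → sym (split (h (x + + 1)) (h x) c ((x + + 1) ^ suc n) (x ^ suc n) (x ^ n) (+ suc n)))
        (FunDegLt-+ n {Δ (λ y → h y - c * y ^ suc n)} (FunDegLt-Δ n {λ y → h y - c * y ^ suc n} top)
                      (FunDegLt-*ˡ n c {binomialRemainder n} (FunDegLt-binomialRemainder n)))
      where
      split : ∀ a b c Y X Z M → a - b - c * M * Z ≡ (a - c * Y - (b - c * X)) + c * (Y - X - M * Z)
      split = solve-∀

  Δ^-FunTopCoeff : ∀ n c h → FunTopCoeff n c h → ∀ x → Δ^ n h x ≡ + (n !) * c
  Δ^-FunTopCoeff zero    c h h≡c x = trans (sym (shift (h x) c)) (trans (cong (λ t → t + c) (h≡c x)) (unit c))
    where
    shift : ∀ a c → a - c * + 1 + c ≡ a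
    shift = solve-∀
    unit : ∀ c → + 0 + c ≡ + 1 * c
    unit = solve-∀
  Δ^-FunTopCoeff (suc n) c h top x = begin
    Δ^ n (Δ h) x            ≡⟨ Δ^-FunTopCoeff n (c * + suc n) (Δ h) (FunTopCoeff-Δ n c h top) x ⟩
    + (n !) * (c * + suc n) ≡⟨ regroup (+ (n !)) c (+ suc n) ⟩
    + suc n * + (n !) * c   ≡⟨ cong (_* c) (sym (pos-* (suc n) (n !))) ⟩
    + (suc n !) * c         ∎
    where
    open ≡-Reasoning
    regroup : ∀ a c b → a * (c * b) ≡ b * a * c
    regroup = solve-∀

  ∣-Δ^ : ∀ {m} n h → (∀ x → m ∣ h x) → ∀ x → m ∣ Δ^ n h x
  ∣-Δ^ zero    h m∣h = m∣h
  ∣-Δ^ (suc n) h m∣h = ∣-Δ^ n (Δ h) (λ x → ∣m∣n⇒∣m-n (m∣h (x + + 1)) (m∣h x))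

  -- The n-th difference of a polynomial of degree ≤ n is n! times its top coefficient.
  NullMod⇒∣factorial*coeff : ∀ m n f → NullMod m f → DegLt (suc n) f → + m ∣ + (n !) * coeff f n
  NullMod⇒∣factorial*coeff m n f null f<n+1 =
    subst (+ m ∣_) (Δ^-FunTopCoeff n (coeff f n) (eval f) (proj₂ (eval-FunDegLt (suc n) f f<n+1)) (+ 0))
      (∣-Δ^ n (eval f) (λ x → ∣ᵤ⇒∣ (null x)) (+ 0))
module Radix (q : ℕ) where

  p : ℕ
  p = suc (suc q)

  module Digits where

    open import Data.Nat using (_+_; _*_; _^_)
    open import Data.Nat.Properties using (+-assoc; *-identityˡ; *-zeroʳ)
    open import Data.Nat.Tactic.RingSolver using (solve-∀)

    -- For es = (e_i, e_{i+1}, ...), digitValue i es = Σ_k e_k p^k is the degree of Hfrom p i es;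
    -- if e_0, e_1, ... are the base-p digits of n, then digitWeight 0 es = Σ_k e_k I_p(k) is the
    -- exponent of p in n! (Legendre's formula).
    digitValue : ℕ → List ℕ → ℕ
    digitValue i []       = 0
    digitValue i (k ∷ es) = k * p ^ i + digitValue (suc i) es

    digitWeight : ℕ → List ℕ → ℕ
    digitWeight i []       = 0
    digitWeight i (k ∷ es) = k * I p i + digitWeight (suc i) es

    I-suc : ∀ i → I p (suc i) ≡ p ^ i + I p i
    I-suc zero    = cong suc (*-zeroʳ p)
    I-suc (suc i) = trans (cong (λ t → suc (p * t)) (I-suc i)) (distrib p (p ^ i) (I p i))
      where
      distrib : ∀ p a b → suc (p * (a + b)) ≡ p * a + suc (p * b)
      distrib = solve-∀

    digitValue-suc : ∀ i es → digitValue (suc i) es ≡ p * digitValue i es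
    digitValue-suc i []       = sym (*-zeroʳ p)
    digitValue-suc i (k ∷ es) = trans (cong (λ t → k * p ^ suc i + t) (digitValue-suc (suc i) es))
                                      (distrib p k (p ^ i) (digitValue (suc i) es))
      where
      distrib : ∀ p k a b → k * (p * a) + p * b ≡ p * (k * a + b)
      distrib = solve-∀

    digitWeight-suc : ∀ i es → digitWeight (suc i) es ≡ digitValue i es + digitWeight i es
    digitWeight-suc i []       = refl
    digitWeight-suc i (k ∷ es) =
      trans (cong₂ (λ a b → k * a + b) (I-suc i) (digitWeight-suc (suc i) es))
            (regroup k (p ^ i) (I p i) (digitValue (suc i) es) (digitWeight (suc i) es))
      where
      regroup : ∀ k a b c d → k * (a + b) + (c + d) ≡ k * a + c + (k * b + d)
      regroup = solve-∀

    digitValue-incE : ∀ i es → digitValue i (incE es) ≡ p ^ i + digitValue i es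
    digitValue-incE i []       = cong (_+ 0) (*-identityˡ (p ^ i))
    digitValue-incE i (k ∷ es) = +-assoc (p ^ i) (k * p ^ i) _

    digitWeight-incE : ∀ i es → digitWeight i (incE es) ≡ I p i + digitWeight i es
    digitWeight-incE i []       = cong (_+ 0) (*-identityˡ (I p i))
    digitWeight-incE i (k ∷ es) = +-assoc (I p i) (k * I p i) _

  module Exponents where

    open import Data.Nat using (_≤_; _<_; _⊔_; _≟_; _≤?_; _+_; z≤n; s≤s)
    open import Data.Nat.Properties
      using (≤-pred; <⇒≤; <⇒≢; ≤∧≢⇒<; ⊔-lub; m≤n⇒m⊔n≡n; m≥n⇒m⊔n≡m; 1+n≰n; <-irrefl;
             *-zeroʳ; +-suc; *-identityʳ)
    open import Data.List.Relation.Unary.All using (All; []; _∷_)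
    open import Data.Bool using (if_then_else_)
    open import Relation.Nullary using (yes; no)
    open import Relation.Nullary.Decidable using (dec-true; dec-false)
    open Digits

    AllBelow : List ℕ → Set
    AllBelow = All (_< p)

    data OneAtP : List ℕ → Set where
      here  : ∀ {es} → AllBelow es → OneAtP (p ∷ es)
      there : ∀ {k es} → k < p → OneAtP es → OneAtP (k ∷ es)

    maxE-AllBelow : ∀ {es} → AllBelow es → maxE es < p
    maxE-AllBelow []            = s≤s z≤n
    maxE-AllBelow (k<p ∷ es<p) = ⊔-lub k<p (maxE-AllBelow es<p)

    maxE-OneAtP : ∀ {es} → OneAtP es → maxE es ≡ p
    maxE-OneAtP (here es<p)               = m≥n⇒m⊔n≡m (<⇒≤ (maxE-AllBelow es<p))
    maxE-OneAtP {k ∷ es} (there k<p one) = trans (cong (k ⊔_) (maxE-OneAtP one)) (m≤n⇒m⊔n≡n (<⇒≤ k<p))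

    incE-shape : ∀ {es} → AllBelow es → AllBelow (incE es) ⊎ OneAtP (incE es)
    incE-shape []                      = inj₁ (s≤s (s≤s z≤n) ∷ [])
    incE-shape {k ∷ es} (k<p ∷ es<p) with suc k ≟ p
    ... | yes refl  = inj₂ (here es<p)
    ... | no k+1≢p = inj₁ (≤∧≢⇒< k<p k+1≢p ∷ es<p)

    carryE-here : ∀ es → carryE p (p ∷ es) ≡ 0 ∷ incE es
    carryE-here es = cong (λ b → if b then 0 ∷ incE es else p ∷ carryE p es) (dec-true (p ≟ p) refl)

    carryE-there : ∀ {k} es → k < p → carryE p (k ∷ es) ≡ k ∷ carryE p es
    carryE-there {k} es k<p =
      cong (λ b → if b then 0 ∷ incE es else k ∷ carryE p es) (dec-false (k ≟ p) (<⇒≢ k<p))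

    carryE-shape : ∀ {es} → OneAtP es → AllBelow (carryE p es) ⊎ OneAtP (carryE p es)
    carryE-shape {_ ∷ es} (here es<p) rewrite carryE-here es with incE-shape es<p
    ... | inj₁ below = inj₁ (s≤s z≤n ∷ below)
    ... | inj₂ one   = inj₂ (there (s≤s z≤n) one)
    carryE-shape {k ∷ es} (there k<p one) rewrite carryE-there es k<p with carryE-shape one
    ... | inj₁ below = inj₁ (k<p ∷ below)
    ... | inj₂ one′  = inj₂ (there k<p one′)

    stepE-AllBelow : ∀ {es} → AllBelow es → stepE p es ≡ incE es
    stepE-AllBelow {es} es<p =
      cong (λ b → if b then incE es else carryE p es) (dec-true (maxE es ≤? suc q) (≤-pred (maxE-AllBelow es<p)))

    stepE-OneAtP : ∀ {es} → OneAtP es → stepE p es ≡ carryE p es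
    stepE-OneAtP {es} one =
      cong (λ b → if b then incE es else carryE p es)
           (dec-false (maxE es ≤? suc q) (λ max≤q+1 → 1+n≰n (subst (_≤ suc q) (maxE-OneAtP one) max≤q+1)))

    e-shape : ∀ j → AllBelow (e p j) ⊎ OneAtP (e p j)
    e-shape zero = inj₁ []
    e-shape (suc j) with e-shape j
    ... | inj₁ below rewrite stepE-AllBelow below = incE-shape below
    ... | inj₂ one   rewrite stepE-OneAtP one     = carryE-shape one

    Emax≢p : ∀ j → AllBelow (e p j) → Emax p j ≢ p
    Emax≢p j below max≡p = <-irrefl max≡p (maxE-AllBelow below)

    -- A carry trades p units of weight I_p(i) for one unit of weight
    -- I_p(i+1) = p I_p(i) + 1, and p units of value p^i for one of value p^(i+1).
    digitWeight-carryE : ∀ i {es} → OneAtP es → digitWeight i (carryE p es) ≡ suc (digitWeight i es)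
    digitWeight-carryE i {_ ∷ es} (here _) rewrite carryE-here es | digitWeight-incE (suc i) es = refl
    digitWeight-carryE i {k ∷ es} (there k<p one)
      rewrite carryE-there es k<p | digitWeight-carryE (suc i) one = +-suc _ _

    digitValue-carryE : ∀ i {es} → OneAtP es → digitValue i (carryE p es) ≡ digitValue i es
    digitValue-carryE i {_ ∷ es} (here _) rewrite carryE-here es | digitValue-incE (suc i) es = refl
    digitValue-carryE i {k ∷ es} (there k<p one)
      rewrite carryE-there es k<p | digitValue-carryE (suc i) one = refl

    digitWeight-e : ∀ j → digitWeight 1 (e p j) ≡ j
    digitWeight-e zero = refl
    digitWeight-e (suc j) with e-shape j
    ... | inj₁ below
      rewrite stepE-AllBelow below | digitWeight-incE 1 (e p j) | *-zeroʳ q | digitWeight-e j = refl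
    ... | inj₂ one
      rewrite stepE-OneAtP one | digitWeight-carryE 1 one | digitWeight-e j = refl

    Hdeg : ℕ → ℕ
    Hdeg j = digitValue 1 (e p j)

    Hdeg-suc-AllBelow : ∀ j → AllBelow (e p j) → Hdeg (suc j) ≡ p + Hdeg j
    Hdeg-suc-AllBelow j below =
      trans (cong (digitValue 1) (stepE-AllBelow below))
            (trans (digitValue-incE 1 (e p j)) (cong (_+ Hdeg j) (*-identityʳ p)))

    Hdeg-suc-OneAtP : ∀ j → OneAtP (e p j) → Hdeg (suc j) ≡ Hdeg j
    Hdeg-suc-OneAtP j one = trans (cong (digitValue 1) (stepE-OneAtP one)) (digitValue-carryE 1 one)

  module Legendre (p-prime : Prime p) where

    open import Data.Nat using (_≤_; _<_; _+_; _*_; _^_; _!; _∸_; s≤s)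
    open import Data.Nat.Properties
      using (≤-refl; <⇒≤; <⇒≱; +-identityʳ; +-suc; +-comm; *-zeroʳ; *-identityʳ; *-comm; *-assoc;
             ^-distribˡ-+-*; m^n≢0; m+[n∸m]≡n; m<n+o⇒m∸n<o)
    open import Data.Nat.Divisibility
      using (_∣_; _∤_; divides; ∣⇒≤; ∣m+n∣m⇒∣n; m∣m*n; ∣-trans; *-monoʳ-∣; *-cancelˡ-∣; 1∣_)
    open import Data.Nat.Primality using (euclidsLemma)
    open import Data.Nat.Tactic.RingSolver using (solve-∀)
    open import Data.List.Relation.Unary.All using (_∷_)
    open import Relation.Nullary.Negation using (contradiction)
    open Digits
    open Exponents using (AllBelow; Hdeg; digitWeight-e)
    open ≡-Reasoning

    ExactPower : ℕ → ℕ → Set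
    ExactPower a m = Σ ℕ λ u → m ≡ p ^ a * u × p ∤ u

    p∤1 : p ∤ 1
    p∤1 p∣1 with ∣⇒≤ p∣1
    ... | s≤s ()

    ∤-* : ∀ {u v} → p ∤ u → p ∤ v → p ∤ u * v
    ∤-* p∤u p∤v p∣uv with euclidsLemma _ _ p-prime p∣uv
    ... | inj₁ p∣u = p∤u p∣u
    ... | inj₂ p∣v = p∤v p∣v

    factorial-+digit : ∀ N r → r < p → Σ ℕ λ u → (p * N + r) ! ≡ (p * N) ! * u × p ∤ u
    factorial-+digit N zero    _     = 1 , trans (cong _! (+-identityʳ (p * N))) (sym (*-identityʳ _)) , p∤1
    factorial-+digit N (suc r) r+1<p with factorial-+digit N r (<⇒≤ r+1<p)
    ... | u , eq , p∤u = suc (p * N + r) * u , eq′ , ∤-* p∤next p∤u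
      where
      eq′ : (p * N + suc r) ! ≡ (p * N) ! * (suc (p * N + r) * u)
      eq′ = begin
        (p * N + suc r) !                 ≡⟨ cong _! (+-suc (p * N) r) ⟩
        suc (p * N + r) * (p * N + r) !   ≡⟨ cong (suc (p * N + r) *_) eq ⟩
        suc (p * N + r) * ((p * N) ! * u) ≡⟨ swap (suc (p * N + r)) ((p * N) !) u ⟩
        (p * N) ! * (suc (p * N + r) * u) ∎
        where
        swap : ∀ a b c → a * (b * c) ≡ b * (a * c)
        swap = solve-∀
      p∤next : p ∤ suc (p * N + r)
      p∤next p∣next =
        contradiction (∣⇒≤ (∣m+n∣m⇒∣n (subst (p ∣_) (sym (+-suc (p * N) r)) p∣next) (m∣m*n N))) (<⇒≱ r+1<p)

    factorial-p* : ∀ N → Σ ℕ λ u → (p * N) ! ≡ p ^ N * N ! * u × p ∤ u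
    factorial-p* zero    = 1 , cong _! (*-zeroʳ p) , p∤1
    factorial-p* (suc N) with factorial-p* N | factorial-+digit N (suc q) ≤-refl
    ... | u₁ , eq₁ , p∤u₁ | u₂ , eq₂ , p∤u₂ = u₁ * u₂ , eq , ∤-* p∤u₁ p∤u₂
      where
      eq : (p * suc N) ! ≡ p ^ suc N * suc N ! * (u₁ * u₂)
      eq = begin
        (p * suc N) !                                 ≡⟨ cong _! (last-block q N) ⟩
        suc (p * N + suc q) * (p * N + suc q) !       ≡⟨ cong (suc (p * N + suc q) *_) eq₂ ⟩
        suc (p * N + suc q) * ((p * N) ! * u₂)        ≡⟨ cong (λ t → suc (p * N + suc q) * (t * u₂)) eq₁ ⟩
        suc (p * N + suc q) * (p ^ N * N ! * u₁ * u₂) ≡⟨ regroup q N (p ^ N) (N !) u₁ u₂ ⟩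
        p ^ suc N * suc N ! * (u₁ * u₂)               ∎
        where
        last-block : ∀ q N → suc (suc q) * suc N ≡ suc (suc (suc q) * N + suc q)
        last-block = solve-∀
        regroup : ∀ q N a b c d → suc (suc (suc q) * N + suc q) * (a * b * c * d)
                                  ≡ suc (suc q) * a * (suc N * b) * (c * d)
        regroup = solve-∀

    ExactPower-factorial : ∀ N r {a} → r < p → ExactPower a (N !) → ExactPower (N + a) ((p * N + r) !)
    ExactPower-factorial N r {a} r<p (w , eqw , p∤w) with factorial-p* N | factorial-+digit N r r<p
    ... | u₁ , eq₁ , p∤u₁ | u₂ , eq₂ , p∤u₂ = w * u₁ * u₂ , eq , ∤-* (∤-* p∤w p∤u₁) p∤u₂
      where
      eq : (p * N + r) ! ≡ p ^ (N + a) * (w * u₁ * u₂)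
      eq = begin
        (p * N + r) !                  ≡⟨ eq₂ ⟩
        (p * N) ! * u₂                 ≡⟨ cong (_* u₂) eq₁ ⟩
        p ^ N * N ! * u₁ * u₂          ≡⟨ cong (λ t → p ^ N * t * u₁ * u₂) eqw ⟩
        p ^ N * (p ^ a * w) * u₁ * u₂  ≡⟨ regroup (p ^ N) (p ^ a) w u₁ u₂ ⟩
        p ^ N * p ^ a * (w * u₁ * u₂)  ≡⟨ cong (_* (w * u₁ * u₂)) (sym (^-distribˡ-+-* p N a)) ⟩
        p ^ (N + a) * (w * u₁ * u₂)    ∎
        where
        regroup : ∀ x y w u v → x * (y * w) * u * v ≡ x * y * (w * u * v)
        regroup = solve-∀

    ExactPower-factorial-digits : ∀ es → AllBelow es → ExactPower (digitWeight 0 es) (digitValue 0 es !)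
    ExactPower-factorial-digits []       _             = 1 , refl , p∤1
    ExactPower-factorial-digits (r ∷ es) (r<p ∷ es<p) =
      subst₂ ExactPower (sym weight≡) (cong _! (sym value≡))
        (ExactPower-factorial (digitValue 0 es) r r<p (ExactPower-factorial-digits es es<p))
      where
      value≡ : digitValue 0 (r ∷ es) ≡ p * digitValue 0 es + r
      value≡ = trans (cong (r * 1 +_) (digitValue-suc 0 es)) (shuffle r (p * digitValue 0 es))
        where
        shuffle : ∀ r a → r * 1 + a ≡ a + r
        shuffle = solve-∀
      weight≡ : digitWeight 0 (r ∷ es) ≡ digitValue 0 es + digitWeight 0 es
      weight≡ = trans (cong (_+ digitWeight 1 es) (*-zeroʳ r)) (digitWeight-suc 0 es)

    ExactPower-factorial-Hdeg : ∀ j n → AllBelow (e p j) → Hdeg j ≤ n → n < Hdeg j + p → ExactPower j (n !)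
    ExactPower-factorial-Hdeg j n below Hdeg≤n n<Hdeg+p =
      subst₂ ExactPower weight≡ (cong _! value≡) (ExactPower-factorial-digits (r ∷ e p j) (r<p ∷ below))
      where
      r : ℕ
      r = n ∸ Hdeg j
      r<p : r < p
      r<p = m<n+o⇒m∸n<o n (Hdeg j) n<Hdeg+p
      value≡ : digitValue 0 (r ∷ e p j) ≡ n
      value≡ = trans (cong (_+ Hdeg j) (*-identityʳ r)) (trans (+-comm r (Hdeg j)) (m+[n∸m]≡n Hdeg≤n))
      weight≡ : digitWeight 0 (r ∷ e p j) ≡ j
      weight≡ = trans (cong (_+ digitWeight 1 (e p j)) (*-zeroʳ r)) (digitWeight-e j)

    ^∣-cancel-unit : ∀ b {u c} → p ∤ u → p ^ b ∣ u * c → p ^ b ∣ c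
    ^∣-cancel-unit zero    {c = c} _ _ = 1∣ c
    ^∣-cancel-unit (suc b) {u} {c} p∤u p^b+1∣uc
      with euclidsLemma u c p-prime (∣-trans (m∣m*n (p ^ b)) p^b+1∣uc)
    ... | inj₁ p∣u = contradiction p∣u p∤u
    ... | inj₂ (divides c′ refl) = subst (p * p ^ b ∣_) (*-comm p c′) (*-monoʳ-∣ p p^b∣c′)
      where
      swap : ∀ u c p → u * (c * p) ≡ p * (u * c)
      swap = solve-∀
      p^b∣c′ : p ^ b ∣ c′
      p^b∣c′ = ^∣-cancel-unit b p∤u (*-cancelˡ-∣ p (subst (p * p ^ b ∣_) (swap u c′ p) p^b+1∣uc))

    ExactPower-∣ : ∀ a b {m} c → ExactPower a m → p ^ (a + b) ∣ m * c → p ^ b ∣ c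
    ExactPower-∣ a b c (u , refl , p∤u) p^a+b∣mc =
      ^∣-cancel-unit b p∤u (*-cancelˡ-∣ (p ^ a) {{m^n≢0 p a}}
        (subst₂ _∣_ (^-distribˡ-+-* p a b) (*-assoc (p ^ a) u c) p^a+b∣mc))


  module NullTerms where

    open import Data.Nat as ℕ using (_≤_; _∸_)
    import Data.Nat.Properties as ℕₚ
    open import Data.Integer using (ℤ; +_; -_; _+_; _*_; _-_; _^_)
    open import Data.Integer.Properties using (pos-*; *-identityʳ; *-comm)
    open import Data.Integer.DivMod using (_%ℕ_; _/ℕ_; a≡a%ℕn+[a/ℕn]*n; n%ℕd<d)
    open import Data.Integer.Divisibility.Signed
      using (_∣_; divides; ∣-refl; ∣-trans; ∣m⇒∣m*n; ∣n⇒∣m*n; *-monoʳ-∣; *-monoˡ-∣; ∣⇒∣ᵤ)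
    open import Data.Integer.Tactic.RingSolver using (solve-∀)
    open import Data.List using (foldr)
    open import Data.List.Properties using (map-cong; length-upTo)
    open import Data.List.Membership.Propositional using (_∈_)
    open import Data.List.Membership.Propositional.Properties using (∈-map⁺; ∈-upTo⁺)
    open import Data.List.Relation.Unary.Any using (here; there)
    open Polynomials
    open Digits using (digitWeight)
    open Exponents using (digitWeight-e)
    open ≡-Reasoning

    *-pres-∣ : ∀ {a b u v} → a ∣ u → b ∣ v → a * b ∣ u * v
    *-pres-∣ {b = b} {u} a∣u b∣v = ∣-trans (*-monoˡ-∣ b a∣u) (*-monoʳ-∣ u b∣v)

    ^-pres-∣ : ∀ {a u} k → a ∣ u → a ^ k ∣ u ^ k
    ^-pres-∣ zero    _   = ∣-refl
    ^-pres-∣ (suc k) a∣u = *-pres-∣ a∣u (^-pres-∣ k a∣u)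

    pos-^ : ∀ m n → + (m ℕ.^ n) ≡ (+ m) ^ n
    pos-^ m zero    = refl
    pos-^ m (suc n) = trans (pos-* m (m ℕ.^ n)) (cong (λ t → + m * t) (pos-^ m n))

    pos-^-+ : ∀ m a b → + (m ℕ.^ (a ℕ.+ b)) ≡ + (m ℕ.^ a) * + (m ℕ.^ b)
    pos-^-+ m a b = trans (cong +_ (ℕₚ.^-distribˡ-+-* m a b)) (pos-* (m ℕ.^ a) (m ℕ.^ b))

    pos-^-* : ∀ m a k → + (m ℕ.^ (k ℕ.* a)) ≡ (+ (m ℕ.^ a)) ^ k
    pos-^-* m a k = trans (cong (λ z → + (m ℕ.^ z)) (ℕₚ.*-comm k a))
                          (trans (cong +_ (sym (ℕₚ.^-*-assoc m a k))) (pos-^ (m ℕ.^ a) k))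

    product : List ℤ → ℤ
    product = foldr _*_ (+ 1)

    eval-prodP : ∀ (F : ℕ → Poly) L x → eval (prodP (map F L)) x ≡ product (map (λ i → eval (F i) x) L)
    eval-prodP F []      x = eval-const (+ 1) x
    eval-prodP F (i ∷ L) x = trans (eval-*P (F i) _ x) (cong (eval (F i) x *_) (eval-prodP F L x))

    product-*ˡ : ∀ c (h : ℕ → ℤ) L → product (map (λ i → c * h i) L) ≡ c ^ length L * product (map h L)
    product-*ˡ c h []      = refl
    product-*ˡ c h (i ∷ L) =
      trans (cong (c * h i *_) (product-*ˡ c h L)) (swap c (h i) (c ^ length L) (product (map h L)))
      where
      swap : ∀ c u v w → c * u * (v * w) ≡ c * v * (u * w)
      swap = solve-∀

    ∈⇒∣product : ∀ {z zs} → z ∈ zs → z ∣ product zs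
    ∈⇒∣product {zs = z ∷ zs} (here refl)  = ∣m⇒∣m*n (product zs) ∣-refl
    ∈⇒∣product {zs = y ∷ zs} (there z∈zs) = ∣n⇒∣m*n y (∈⇒∣product z∈zs)

    p∣product-consecutive : ∀ t → + p ∣ product (map (λ i → t - + i) (upTo p))
    p∣product-consecutive t =
      ∣-trans p∣t-r (∈⇒∣product (∈-map⁺ (λ i → t - + i) (∈-upTo⁺ (n%ℕd<d t p))))
      where
      p∣t-r : + p ∣ t - + (t %ℕ p)
      p∣t-r = divides (t /ℕ p) (trans (cong (_- + (t %ℕ p)) (a≡a%ℕn+[a/ℕn]*n t p)) (cancel (+ (t %ℕ p)) _))
        where
        cancel : ∀ r s → r + s - r ≡ s
        cancel = solve-∀

    Gfactor : ℕ → ℕ → Poly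
    Gfactor n i = G p n +P [ - + (i ℕ.* p ℕ.^ I p n) ]

    p^I∣G : ∀ n x → + (p ℕ.^ I p n) ∣ eval (G p n) x
    p^I∣G zero    x = divides (eval xP x) (sym (*-identityʳ _))
    p^I∣G (suc n) x with p^I∣G n x
    ... | divides t G≡tc =
      subst₂ _∣_ (sym p^I[n+1]) (sym eval-G) (*-pres-∣ (∣-refl {(+ c) ^ p}) (p∣product-consecutive t))
      where
      c : ℕ
      c = p ℕ.^ I p n
      factor : ∀ i → eval (Gfactor n i) x ≡ + c * (t - + i)
      factor i = begin
        eval (Gfactor n i) x                      ≡⟨ eval-+P (G p n) _ x ⟩
        eval (G p n) x + eval [ - + (i ℕ.* c) ] x ≡⟨ cong₂ _+_ G≡tc (eval-const _ x) ⟩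
        t * + c + - + (i ℕ.* c)                   ≡⟨ cong (λ s → t * + c + - s) (pos-* i c) ⟩
        t * + c + - (+ i * + c)                   ≡⟨ factor-out t (+ c) (+ i) ⟩
        + c * (t - + i)                           ∎
        where
        factor-out : ∀ t c i → t * c + - (i * c) ≡ c * (t - i)
        factor-out = solve-∀
      consecutive : ℤ
      consecutive = product (map (λ i → t - + i) (upTo p))
      eval-G : eval (G p (suc n)) x ≡ (+ c) ^ p * consecutive
      eval-G = begin
        eval (G p (suc n)) x                                ≡⟨ eval-prodP (Gfactor n) (upTo p) x ⟩
        product (map (λ i → eval (Gfactor n i) x) (upTo p)) ≡⟨ cong product (map-cong factor (upTo p)) ⟩
        product (map (λ i → + c * (t - + i)) (upTo p))      ≡⟨ product-*ˡ (+ c) (λ i → t - + i) (upTo p) ⟩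
        (+ c) ^ length (upTo p) * consecutive
          ≡⟨ cong (λ k → (+ c) ^ k * consecutive) (length-upTo p) ⟩
        (+ c) ^ p * consecutive                             ∎
      p^I[n+1] : + (p ℕ.^ I p (suc n)) ≡ (+ c) ^ p * + p
      p^I[n+1] = begin
        + (p ℕ.* p ℕ.^ (p ℕ.* I p n))    ≡⟨ pos-* p (p ℕ.^ (p ℕ.* I p n)) ⟩
        + p * + (p ℕ.^ (p ℕ.* I p n))    ≡⟨ cong (λ z → + p * z) (pos-^-* p (I p n) p) ⟩
        + p * (+ c) ^ p                  ≡⟨ *-comm (+ p) _ ⟩
        (+ c) ^ p * + p                  ∎

    p^weight∣Hfrom : ∀ i es x → + (p ℕ.^ digitWeight i es) ∣ eval (Hfrom p i es) x
    p^weight∣Hfrom i []       x = divides (eval oneP x) (sym (*-identityʳ _))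
    p^weight∣Hfrom i (k ∷ es) x =
      subst₂ _∣_ (sym p^weight) (sym (eval-*P (G p i ^P k) (Hfrom p (suc i) es) x))
        (*-pres-∣ (subst (_ ∣_) (sym (eval-^P (G p i) k x)) (^-pres-∣ k (p^I∣G i x)))
                  (p^weight∣Hfrom (suc i) es x))
      where
      p^weight : + (p ℕ.^ (k ℕ.* I p i ℕ.+ digitWeight (suc i) es))
                 ≡ (+ (p ℕ.^ I p i)) ^ k * + (p ℕ.^ digitWeight (suc i) es)
      p^weight = trans (pos-^-+ p (k ℕ.* I p i) _)
                       (cong (_* + (p ℕ.^ digitWeight (suc i) es)) (pos-^-* p (I p i) k))

    p^j∣H : ∀ j x → + (p ℕ.^ j) ∣ eval (H p j) x
    p^j∣H j x = subst (λ w → + (p ℕ.^ w) ∣ eval (H p j) x) (digitWeight-e j) (p^weight∣Hfrom 1 (e p j) x)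

    rhsTerm : ℕ → ℕ → Poly → Poly
    rhsTerm d j r = + (p ℕ.^ (d ∸ j)) ·P (H p j *P r)

    p^d∣rhsTerm : ∀ d j r x → j ≤ d → + (p ℕ.^ d) ∣ eval (rhsTerm d j r) x
    p^d∣rhsTerm d j r x j≤d =
      subst₂ _∣_ (sym p^d) (sym eval-term) (*-pres-∣ (∣-refl {c}) (∣m⇒∣m*n (eval r x) (p^j∣H j x)))
      where
      c : ℤ
      c = + (p ℕ.^ (d ∸ j))
      p^d : + (p ℕ.^ d) ≡ c * + (p ℕ.^ j)
      p^d = trans (cong (λ k → + (p ℕ.^ k)) (sym (ℕₚ.m∸n+n≡m j≤d))) (pos-^-+ p (d ∸ j) j)
      eval-term : eval (rhsTerm d j r) x ≡ c * (eval (H p j) x * eval r x)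
      eval-term = trans (eval-·P c (H p j *P r) x) (cong (c *_) (eval-*P (H p j) r x))

    NullMod-rhs : ∀ d q → NullMod (p ℕ.^ d) (rhs p d q)
    NullMod-rhs d q x =
      ∣⇒∣ᵤ (∣-eval-sumP (λ j → rhsTerm d j (q j)) d x (λ j j≤d → p^d∣rhsTerm d j (q j) x j≤d))

  module Necessity (p-prime : Prime p) where

    open import Data.Nat as ℕ using (_≤_; _<_; _∸_; _!; z≤n; s≤s; _≟_; _<?_)
    import Data.Nat.Properties as ℕₚ
    import Data.Nat.Divisibility as ℕ∣
    open import Data.Integer as ℤ using (ℤ; +_; _+_; _*_; _-_)
    import Data.Integer.Divisibility as ℤ∣
    open import Data.Integer.Properties
      using (+-identityʳ; +-inverseʳ; *-zeroʳ; *-identityˡ; *-identityʳ; *-comm; *-distribˡ-+; abs-*)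
    open import Data.Integer.Divisibility.Signed
      using (_∣_; divides; ∣-refl; ∣m⇒∣m*n; ∣m∣n⇒∣m+n; ∣ᵤ⇒∣; ∣⇒∣ᵤ)
    open import Data.Integer.Tactic.RingSolver using (solve-∀)
    open import Data.Empty using (⊥-elim)
    open import Data.List.Properties using (length-upTo)
    open import Relation.Nullary using (yes; no)
    open Polynomials
    open FiniteDifferences using (NullMod⇒∣factorial*coeff)
    open Digits using (digitValue)
    open Exponents
    open Legendre p-prime using (ExactPower-factorial-Hdeg; ExactPower-∣)
    open NullTerms
    open ≡-Reasoning

    TopCoeff-G : ∀ n → TopCoeff (p ℕ.^ n) (+ 1) (G p n)
    TopCoeff-G zero    = TopCoeff-xP
    TopCoeff-G (suc n) =
      subst (λ k → TopCoeff k (+ 1) (G p (suc n))) (cong (ℕ._* p ℕ.^ n) (length-upTo p))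
        (TopCoeff-prodP (Gfactor n) (upTo p) (λ i → TopCoeff-+P-const (G p n) _ (ℕₚ.m^n>0 p n) (TopCoeff-G n)))

    TopCoeff-Hfrom : ∀ i es → TopCoeff (digitValue i es) (+ 1) (Hfrom p i es)
    TopCoeff-Hfrom i []       = TopCoeff-oneP
    TopCoeff-Hfrom i (k ∷ es) =
      TopCoeff-*P (G p i ^P k) (Hfrom p (suc i) es) (TopCoeff-^P (G p i) k (TopCoeff-G i)) (TopCoeff-Hfrom (suc i) es)

    Admissible : ℕ → (ℕ → Poly) → Set
    Admissible d q = ∀ j → 1 ≤ j → j < d → (Emax p j ≡ p → IsZeroP (q j)) × (Emax p j ≢ p → DegLt p (q j))

    Representable : ℕ → Poly → Set
    Representable d f = Σ (ℕ → Poly) λ q → Admissible d q × CongMod (p ℕ.^ d) f (rhs p d q)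

    Representable-resp : ∀ d f g → (∀ k → coeff f k ≡ coeff g k) → Representable d g → Representable d f
    Representable-resp d f g f≡g (q , adm , g≡rhs) =
      q , adm , λ k → subst (λ z → + (p ℕ.^ d) ℤ∣.∣ z - coeff (rhs p d q) k) (sym (f≡g k)) (g≡rhs k)

    coeff-rhsTerm-[] : ∀ d j k → coeff (rhsTerm d j []) k ≡ + 0
    coeff-rhsTerm-[] d j k =
      trans (coeff-·P c (H p j *P []) k) (trans (cong (c *_) (*P-zeroʳ (H p j) k)) (*-zeroʳ c))
      where
      c : ℤ
      c = + (p ℕ.^ (d ∸ j))

    Representable-multiple : ∀ d f → (∀ k → + (p ℕ.^ d) ∣ coeff f k) → Representable d f
    Representable-multiple d f p^d∣f = (λ _ → []) , (λ _ _ _ → (λ _ _ → refl) , (λ _ _ _ → refl)) , λ k →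
      ∣⇒∣ᵤ (subst (+ (p ℕ.^ d) ∣_) (sym (f-rhs≡f k)) (p^d∣f k))
      where
      rhs≡0 : ∀ k → coeff (rhs p d (λ _ → [])) k ≡ + 0
      rhs≡0 k = coeff-sumP-zero (λ j → rhsTerm d j []) d k (λ j _ → coeff-rhsTerm-[] d j k)
      f-rhs≡f : ∀ k → coeff f k - coeff (rhs p d (λ _ → [])) k ≡ coeff f k
      f-rhs≡f k = trans (cong (λ z → coeff f k - z) (rhs≡0 k)) (+-identityʳ _)

    coeff-rhsTerm-+P : ∀ d j r s k →
                       coeff (rhsTerm d j (r +P s)) k ≡ coeff (rhsTerm d j r) k + coeff (rhsTerm d j s) k
    coeff-rhsTerm-+P d j r s k = begin
      coeff (c ·P (H p j *P (r +P s))) k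
        ≡⟨ coeff-·P c (H p j *P (r +P s)) k ⟩
      c * coeff (H p j *P (r +P s)) k
        ≡⟨ cong (c *_) (coeff-*P-+P (H p j) r s k) ⟩
      c * (coeff (H p j *P r) k + coeff (H p j *P s) k)
        ≡⟨ *-distribˡ-+ c _ _ ⟩
      c * coeff (H p j *P r) k + c * coeff (H p j *P s) k
        ≡⟨ sym (cong₂ _+_ (coeff-·P c (H p j *P r) k) (coeff-·P c (H p j *P s) k)) ⟩
      coeff (rhsTerm d j r) k + coeff (rhsTerm d j s) k ∎
      where
      c : ℤ
      c = + (p ℕ.^ (d ∸ j))

    Admissible-+ : ∀ d q q′ → Admissible d q → Admissible d q′ → Admissible d (λ j → q j +P q′ j)
    Admissible-+ d q q′ adm adm′ j 1≤j j<d =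
      (λ max≡p → IsZeroP-+P (q j) (q′ j) (proj₁ (adm j 1≤j j<d) max≡p) (proj₁ (adm′ j 1≤j j<d) max≡p)) ,
      (λ max≢p → DegLt-+P (q j) (q′ j) (proj₂ (adm j 1≤j j<d) max≢p) (proj₂ (adm′ j 1≤j j<d) max≢p))

    Representable-+ : ∀ d f g → Representable d f → Representable d g → Representable d (f +P g)
    Representable-+ d f g (q , adm , f≡rhs) (q′ , adm′ , g≡rhs) =
      (λ j → q j +P q′ j) , Admissible-+ d q q′ adm adm′ , λ k →
      ∣⇒∣ᵤ (subst (+ (p ℕ.^ d) ∣_) (sum≡ k)
        (∣m∣n⇒∣m+n (∣ᵤ⇒∣ {i = coeff f k - coeff (rhs p d q) k} (f≡rhs k))
                   (∣ᵤ⇒∣ {i = coeff g k - coeff (rhs p d q′) k} (g≡rhs k))))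
      where
      sum≡ : ∀ k → (coeff f k - coeff (rhs p d q) k) + (coeff g k - coeff (rhs p d q′) k)
                   ≡ coeff (f +P g) k - coeff (rhs p d (λ j → q j +P q′ j)) k
      sum≡ k = begin
        (coeff f k - coeff (rhs p d q) k) + (coeff g k - coeff (rhs p d q′) k)
          ≡⟨ regroup (coeff f k) (coeff g k) (coeff (rhs p d q) k) (coeff (rhs p d q′) k) ⟩
        (coeff f k + coeff g k) - (coeff (rhs p d q) k + coeff (rhs p d q′) k)
          ≡⟨ sym (cong₂ _-_ (coeff-+P f g k)
                            (coeff-sumP-additive _ _ _ d k (λ j → coeff-rhsTerm-+P d j (q j) (q′ j) k))) ⟩
        coeff (f +P g) k - coeff (rhs p d (λ j → q j +P q′ j)) k ∎
        where
        regroup : ∀ a b c e → (a - c) + (b - e) ≡ (a + b) - (c + e)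
        regroup = solve-∀

    single : ℕ → Poly → ℕ → Poly
    single j r i with i ≟ j
    ... | yes _ = r
    ... | no  _ = []

    single-≡ : ∀ j r → single j r j ≡ r
    single-≡ j r with j ≟ j
    ... | yes _   = refl
    ... | no  j≢j = ⊥-elim (j≢j refl)

    Representable-rhsTerm : ∀ d j r → 1 ≤ j → j ≤ d → (j < d → AllBelow (e p j) × DegLt p r) →
                            Representable d (rhsTerm d j r)
    Representable-rhsTerm d j r 1≤j j≤d below = single j r , admissible , λ k →
      subst (+ (p ℕ.^ d) ℤ∣.∣_)
            (sym (trans (cong (λ z → coeff (rhsTerm d j r) k - z) (rhs≡ k)) (+-inverseʳ (coeff (rhsTerm d j r) k))))
            ((p ℕ.^ d) ℕ∣.∣0)
      where
      admissible : Admissible d (single j r)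
      admissible i 1≤i i<d with i ≟ j
      ... | yes refl = (λ max≡p → ⊥-elim (Emax≢p i (proj₁ (below i<d)) max≡p)) , (λ _ → proj₂ (below i<d))
      ... | no  _    = (λ _ _ → refl) , (λ _ _ _ → refl)
      off : ∀ k i → i ≢ j → coeff (rhsTerm d i (single j r i)) k ≡ + 0
      off k i i≢j with i ≟ j
      ... | yes i≡j = ⊥-elim (i≢j i≡j)
      ... | no  _   = coeff-rhsTerm-[] d i k
      rhs≡ : ∀ k → coeff (rhs p d (single j r)) k ≡ coeff (rhsTerm d j r) k
      rhs≡ k = trans (coeff-sumP-single (λ i → rhsTerm d i (single j r i)) d k 1≤j j≤d (off k))
                     (cong (λ z → coeff (rhsTerm d j z) k) (single-≡ j r))

    -- Peel d n j: the top coefficient of a null polynomial of degree ≤ n can be cancelled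
    -- by p^{d-j} H_{p,j} times a monomial admissible as a summand of q_j.
    data Peel (d n : ℕ) : ℕ → Set where
      last  : Hdeg d ≤ n → Peel d n d
      digit : ∀ {j} → j < d → AllBelow (e p j) → Hdeg j ≤ n → n < Hdeg j ℕ.+ p → Peel d n j

    choosePeel : ∀ d n → Σ ℕ (Peel d n)
    choosePeel zero    n = 0 , last z≤n
    choosePeel (suc d) n with choosePeel d n
    ... | j , digit j<d below Hdeg≤n n< = j , digit (ℕₚ.m<n⇒m<1+n j<d) below Hdeg≤n n<
    ... | _ , last Hdeg≤n with e-shape d
    ...   | inj₂ one = suc d , last (subst (_≤ n) (sym (Hdeg-suc-OneAtP d one)) Hdeg≤n)
    ...   | inj₁ below with n <? Hdeg d ℕ.+ p
    ...     | yes n< = d , digit (ℕₚ.n<1+n d) below Hdeg≤n n<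
    ...     | no  n≮ = suc d , last (subst (_≤ n) (sym Hdeg[d+1]) (ℕₚ.≮⇒≥ n≮))
      where
      Hdeg[d+1] : Hdeg (suc d) ≡ Hdeg d ℕ.+ p
      Hdeg[d+1] = trans (Hdeg-suc-AllBelow d below) (ℕₚ.+-comm p (Hdeg d))

    Peel⇒≤ : ∀ {d n j} → Peel d n j → j ≤ d
    Peel⇒≤ (last _)          = ℕₚ.≤-refl
    Peel⇒≤ (digit j<d _ _ _) = ℕₚ.<⇒≤ j<d

    Peel⇒Hdeg≤ : ∀ {d n j} → Peel d n j → Hdeg j ≤ n
    Peel⇒Hdeg≤ (last Hdeg≤n)        = Hdeg≤n
    Peel⇒Hdeg≤ (digit _ _ Hdeg≤n _) = Hdeg≤n

    p^[d∸j]∣topCoeff : ∀ {d n j} f → Peel d n j → NullMod (p ℕ.^ d) f → DegLt (suc n) f →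
                       + (p ℕ.^ (d ∸ j)) ∣ coeff f n
    p^[d∸j]∣topCoeff {d} {n} f (last _) _ _ =
      subst (λ k → + (p ℕ.^ k) ∣ coeff f n) (sym (ℕₚ.n∸n≡0 d)) (divides (coeff f n) (sym (*-identityʳ _)))
    p^[d∸j]∣topCoeff {d} {n} {j} f (digit j<d below Hdeg≤n n<) null f<n+1 =
      ∣ᵤ⇒∣ (ExactPower-∣ j (d ∸ j) ℤ.∣ coeff f n ∣ (ExactPower-factorial-Hdeg j n below Hdeg≤n n<) p^d∣n!*c)
      where
      p^d∣n!*c : p ℕ.^ (j ℕ.+ (d ∸ j)) ℕ∣.∣ n ! ℕ.* ℤ.∣ coeff f n ∣
      p^d∣n!*c = subst₂ ℕ∣._∣_ (cong (p ℕ.^_) (sym (ℕₚ.m+[n∸m]≡n (ℕₚ.<⇒≤ j<d)))) (abs-* (+ (n !)) (coeff f n))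
                        (∣⇒∣ᵤ (NullMod⇒∣factorial*coeff _ n f null f<n+1))

    peelTerm : ℕ → ℕ → ℕ → ℤ → Poly
    peelTerm d n j w = rhsTerm d j (monomial w (n ∸ Hdeg j))

    TopCoeff-peelTerm : ∀ {d n j} w → Peel d n j → TopCoeff n (+ (p ℕ.^ (d ∸ j)) * w) (peelTerm d n j w)
    TopCoeff-peelTerm {d} {n} {j} w peel =
      subst₂ (λ m u → TopCoeff m u (peelTerm d n j w)) (ℕₚ.m+[n∸m]≡n (Peel⇒Hdeg≤ peel))
             (cong (c *_) (*-identityˡ w))
        (TopCoeff-·P c (H p j *P monomial w k)
          (TopCoeff-*P (H p j) (monomial w k) (TopCoeff-Hfrom 1 (e p j)) (TopCoeff-monomial w k)))
      where
      c : ℤ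
      c = + (p ℕ.^ (d ∸ j))
      k : ℕ
      k = n ∸ Hdeg j

    Representable-peelTerm : ∀ {d n j} w → Peel d n j → Representable d (peelTerm d n j w)
    Representable-peelTerm {d} {n} {zero} w _ = Representable-multiple d (peelTerm d n 0 w) λ k →
      subst (+ (p ℕ.^ d) ∣_) (sym (coeff-·P (+ (p ℕ.^ d)) Hw k)) (∣m⇒∣m*n (coeff Hw k) ∣-refl)
      where
      Hw : Poly
      Hw = H p 0 *P monomial w n
    Representable-peelTerm {d} {n} {suc j} w peel =
      Representable-rhsTerm d (suc j) (monomial w (n ∸ Hdeg (suc j))) (s≤s z≤n) (Peel⇒≤ peel) (admissible peel)
      where
      admissible : Peel d n (suc j) → suc j < d → AllBelow (e p (suc j)) × DegLt p (monomial w (n ∸ Hdeg (suc j)))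
      admissible (last _)             j<j = ⊥-elim (ℕₚ.<-irrefl refl j<j)
      admissible (digit _ below _ n<) _   = below , λ k p≤k →
        proj₁ (TopCoeff-monomial w _) k (ℕₚ.<-≤-trans (ℕₚ.m<n+o⇒m∸n<o n (Hdeg (suc j)) n<) p≤k)

    NullMod⇒Representable : ∀ d n f → DegLt n f → NullMod (p ℕ.^ d) f → Representable d f
    NullMod⇒Representable d zero    f f<0   _    =
      Representable-multiple d f (λ k → subst (+ (p ℕ.^ d) ∣_) (sym (f<0 k z≤n)) (divides (+ 0) refl))
    NullMod⇒Representable d (suc n) f f<n+1 null with choosePeel d n
    ... | j , peel with p^[d∸j]∣topCoeff f peel null f<n+1
    ... | divides w top≡w*c =
      Representable-resp d f ((f -P t) +P t) f≡rest+t
        (Representable-+ d (f -P t) t (NullMod⇒Representable d n (f -P t) rest<n rest-null)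
                                      (Representable-peelTerm w peel))
      where
      t : Poly
      t = peelTerm d n j w
      rest<n : DegLt n (f -P t)
      rest<n = DegLt-dropTop f t f<n+1
        (subst (λ u → TopCoeff n u t) (trans (*-comm _ w) (sym top≡w*c)) (TopCoeff-peelTerm w peel))
      rest-null : NullMod (p ℕ.^ d) (f -P t)
      rest-null = NullMod--P f t null
        (λ x → ∣⇒∣ᵤ (p^d∣rhsTerm d j (monomial w (n ∸ Hdeg j)) x (Peel⇒≤ peel)))
      f≡rest+t : ∀ k → coeff f k ≡ coeff ((f -P t) +P t) k
      f≡rest+t k = sym (begin
        coeff ((f -P t) +P t) k         ≡⟨ coeff-+P (f -P t) t k ⟩
        coeff (f -P t) k + coeff t k    ≡⟨ cong (λ z → z + coeff t k) (coeff--P f t k) ⟩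
        coeff f k - coeff t k + coeff t k ≡⟨ cancel (coeff f k) (coeff t k) ⟩
        coeff f k                       ∎)
        where
        cancel : ∀ a b → a - b + b ≡ a
        cancel = solve-∀

open import Data.Nat using (_≤_; _<_; _^_)

mainTheorem3 : (p : ℕ) → Prime p → (d : ℕ) → 1 ≤ d → (f : Poly) →
    NullMod (p ^ d) f ⇔
    Σ (ℕ → Poly) (λ q →
    (∀ j → 1 ≤ j → j < d →
    (Emax p j ≡ p → IsZeroP (q j)) × (Emax p j ≢ p → DegLt p (q j)))
    × CongMod (p ^ d) f (rhs p d q))
mainTheorem3 zero          p-prime with () ← nonTrivial⇒n>1 0 {{prime⇒nonTrivial p-prime}}
mainTheorem3 (suc zero)    p-prime with s≤s () ← nonTrivial⇒n>1 1 {{prime⇒nonTrivial p-prime}}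
mainTheorem3 (suc (suc q)) p-prime d _ f =
  mk⇔ (NullMod⇒Representable d (length f) f (DegLt-length f))
      (λ (r , _ , f≡rhs) → NullMod-resp-CongMod f (rhs (suc (suc q)) d r) f≡rhs (NullMod-rhs d r))
  where
  open Polynomials using (NullMod-resp-CongMod; DegLt-length)
  open Radix q using (module NullTerms; module Necessity)
  open NullTerms using (NullMod-rhs)
  open Necessity p-prime using (NullMod⇒Representable)
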